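{- Let $G$ be a graph with vertices $v,w$ such that $\mathrm{d}(v,w)\geq 5$, and let $G':=\mathrm{vid}(G,[v,w])$ with identified vertex denoted $vw$. If $\sigma\subseteq N_{G'}(vw)$ satisfies $\sigma\cap N_G(v)\neq\emptyset$ and $\sigma\cap N_G(w)\neq\emptyset$, then $\sigma\notin\mathcal{N}(G)$.
   Context: $\mathrm{d}$ is graph distance. $\mathrm{vid}(G,[v,w])$ identifies the nonadjacent vertices $v,w$ into one vertex $vw$ (adjacent to $N_G(v)\cup N_G(w)$), ignoring multiple edges. The neighborhood complex $\mathcal{N}(G)$ is the simplicial complex on $V(G)$ whose faces are all subsets of the sets $N_G(u)$, $u\in V(G)$, where $N_G(u)$ is the neighbor set of $u$. -}

module Defs where

open import Data.Nat using (ℕ; zero; suc; _≤_)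
open import Data.Fin using (Fin)
open import Data.Maybe using (Maybe; just; nothing)
open import Data.Product using (Σ; ∃; ∃-syntax; _×_; _,_)
open import Data.Sum using (_⊎_)
open import Data.Empty using (⊥)
open import Relation.Nullary using (¬_)
open import Relation.Binary.PropositionalEquality using (_≡_; _≢_)

record Graph (V : Set) : Set₁ where
  field
    Adj   : V → V → Set
    sym   : ∀ {x y} → Adj x y → Adj y x
    irrefl : ∀ {x} → ¬ Adj x x
open Graph public

N : ∀ {V} → Graph V → V → V → Set
N G u x = Adj G u x

data Walk {V : Set} (G : Graph V) : ℕ → V → V → Set where
  here : ∀ {x} → Walk G zero x x
  step : ∀ {k x y z} → Adj G x y → Walk G k y z → Walk G (suc k) x z

-- d(x,y) ≥ m : there is no walk of length < m from x to y
-- (in particular holds when x,y lie in different components, d = ∞).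
dist≥ : ∀ {V} → Graph V → V → V → ℕ → Set
dist≥ G x y m = ∀ k → suc k ≤ m → ¬ Walk G k x y

-- Vertex set of vid(G,[v,w]): nothing = the identified vertex vw,
-- just (u , _) = an old vertex u different from v and w.
VidV : ∀ {V : Set} → V → V → Set
VidV {V} v w = Maybe (Σ V λ u → (u ≢ v) × (u ≢ w))

VidAdj : ∀ {V} (G : Graph V) (v w : V) → VidV v w → VidV v w → Set
VidAdj G v w nothing  nothing         = ⊥
VidAdj G v w nothing  (just (u , _))  = Adj G v u ⊎ Adj G w u
VidAdj G v w (just (u , _)) nothing   = Adj G v u ⊎ Adj G w u
VidAdj G v w (just (u , _)) (just (u' , _)) = Adj G u u'

private
  vsym : ∀ {V} (G : Graph V) (v w : V) {x y : VidV v w} →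
         VidAdj G v w x y → VidAdj G v w y x
  vsym G v w {nothing} {nothing} ()
  vsym G v w {nothing} {just _} a = a
  vsym G v w {just _} {nothing} a = a
  vsym G v w {just _} {just _} a = sym G a

  virr : ∀ {V} (G : Graph V) (v w : V) {x : VidV v w} → ¬ VidAdj G v w x x
  virr G v w {nothing} ()
  virr G v w {just _} a = irrefl G a

-- vid(G,[v,w]) (simple graph: multiple edges are ignored automatically)
vid : ∀ {V} (G : Graph V) (v w : V) → Graph (VidV v w)
vid G v w = record { Adj = VidAdj G v w ; sym = λ {x} {y} → vsym G v w {x} {y} ; irrefl = λ {x} → virr G v w {x} }

Subset : Set → Set₁
Subset V = V → Set

_⊆_ : ∀ {V} → Subset V → Subset V → Set
σ ⊆ τ = ∀ x → σ x → τ x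

_∈𝒩_ : ∀ {V} → Subset V → Graph V → Set
σ ∈𝒩 G = ∃[ u ] (σ ⊆ N G u)

-- A subset of V(G') that avoids vw, viewed as a subset of V(G)
-- (old vertices of G' are identified with the corresponding vertices of G).
toG : ∀ {V} {v w : V} → Subset (VidV v w) → Subset V
toG {v = v} {w} σ u = Σ ((u ≢ v) × (u ≢ w)) λ p → σ (just (u , p))

module Submission where

open import Defs
open import Data.Fin using (Fin)
open import Data.Nat using (ℕ; _+_)
open import Data.Nat.Properties using (≤-refl)
open import Data.Maybe using (nothing)
open import Data.Product using (∃-syntax; _×_; _,_)
open import Relation.Nullary using (¬_)

-- The face lies in some N_G(x); its vertex u next to v and its vertex u' next
-- to w give the walk v – u – x – u' – w, so d(v,w) ≤ 4.

_++ʷ_ : ∀ {V} {G : Graph V} {k l x y z} →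
  Walk G k x y → Walk G l y z → Walk G (k + l) x z
here     ++ʷ q = q
step a p ++ʷ q = step a (p ++ʷ q)

walk-through-common-neighbour : ∀ {V} (G : Graph V) {x u u'} →
  N G x u → N G x u' → Walk G 2 u u'
walk-through-common-neighbour G xu xu' = step (sym G xu) (step xu' here)

face-meeting-both-neighbourhoods-walk : ∀ {V} (G : Graph V) {v w : V} (τ : Subset V) →
  τ ∈𝒩 G →
  ∃[ u ] (τ u × N G v u) →
  ∃[ u ] (τ u × N G w u) →
  Walk G 4 v w
face-meeting-both-neighbourhoods-walk G τ (x , τ⊆Nx) (u , τu , vu) (u' , τu' , wu') =
  step vu (walk-through-common-neighbour G (τ⊆Nx u τu) (τ⊆Nx u' τu') ++ʷ step (sym G wu') here)

lemma3p5 : ∀ {n : ℕ} (G : Graph (Fin n)) (v w : Fin n) →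
    dist≥ G v w 5 →
    (σ : Subset (VidV v w)) →
    σ ⊆ N (vid G v w) nothing →
    (∃[ u ] (toG σ u × N G v u)) →
    (∃[ u ] (toG σ u × N G w u)) →
    ¬ (toG σ ∈𝒩 G)
lemma3p5 G v w d≥5 σ _ meets-v meets-w face =
  d≥5 4 ≤-refl (face-meeting-both-neighbourhoods-walk G (toG σ) face meets-v meets-w)
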